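{- Let $E$ be a propositional variable and $\delta$ a new atomic formula symbol. The logic $\mathsf{QLP}^-(\delta\leftrightarrow[(\exists x)x:\neg\delta\vee(E\wedge\neg(\exists x)x:(\delta\rightarrow E))])_{\emptyset}$, i.e. $\mathsf{QLP}^-$ without Axiom Necessitation, over the language extended by $\delta$, with this single additional axiom, is consistent.
   Context: Fix countably many justification variables, propositional variables, and primitive function symbols of each arity $n\ge0$; a primitive term is $f(x_1,\dots,x_n)$. Terms of $\mathsf{QLP}^-$: $t::= x\mid f(x_1,\dots,x_n)\mid t\cdot t\mid t+t\mid !t$. Formulas: $A::= p\mid\bot\mid\neg A\mid A\wedge A\mid A\vee A\mid A\rightarrow A\mid t:A\mid(\forall x)A\mid(\exists x)A$. Axioms: all propositional tautologies; Q1: $(\forall x)A(x)\rightarrow A(t)$, $t$ free for $x$; Q2: $(\forall x)(A\rightarrow B(x))\rightarrow(A\rightarrow(\forall x)B(x))$, $x$ not free in $A$; Q3: $A(t)\rightarrow(\exists x)A(x)$, $t$ free for $x$; Q4: $(\forall x)(A(x)\rightarrow B)\rightarrow((\exists x)A(x)\rightarrow B)$, $x$ not free in $B$; jK: $s:(A\rightarrow B)\rightarrow(t:A\rightarrow(s\cdot t):B)$; jT: $t:A\rightarrow A$; j4: $t:A\rightarrow !t:t:A$; Sum: $s:A\rightarrow(s+t):A$, $s:A\rightarrow(t+s):A$. Rules: Modus Ponens; Gen: from $A$ infer $(\forall x)A$; Axiom Necessitation: from an axiom instance $A$ infer $f(x_1,\dots,x_n):A$. The subscript $\emptyset$ means Axiom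 Necessitation is dropped. All schemes and rules apply to formulas of the extended language. -}

module Defs where

open import Data.Nat using (ℕ; _≡ᵇ_)
open import Data.Bool using (Bool; true; false; _∧_; _∨_; not; if_then_else_)
open import Data.Vec using (Vec)
import Data.Vec as Vec
open import Data.Maybe using (Maybe; just; nothing)
import Data.Maybe as Maybe
open import Relation.Binary.PropositionalEquality using (_≡_)
open import Relation.Nullary using (¬_)

-- Justification variables are natural numbers (the same variables are
-- bound by the quantifiers).  A primitive function symbol of arity n is
-- indexed by (n , i); a primitive term is f(x₁,…,xₙ) with variables xᵢ.

infixl 7 _·_
infixl 6 _⊕_

data Term : Set where
  var  : ℕ → Term
  prim : (n i : ℕ) → Vec ℕ n → Term
  _·_  : Term → Term → Term
  _⊕_  : Term → Term → Term
  !_   : Term → Term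

infixr 4 _⇒_
infixr 5 _∨f_
infixr 6 _∧f_
infix  8 _∶_

data Formula : Set where
  pv    : ℕ → Formula
  δ     : Formula
  ⊥f    : Formula
  ¬f    : Formula → Formula
  _∧f_  : Formula → Formula → Formula
  _∨f_  : Formula → Formula → Formula
  _⇒_   : Formula → Formula → Formula
  _∶_   : Term → Formula → Formula
  ∀f    : ℕ → Formula → Formula
  ∃f    : ℕ → Formula → Formula

_⇔_ : Formula → Formula → Formula
A ⇔ B = (A ⇒ B) ∧f (B ⇒ A)

anyVec : ∀ {n} → (ℕ → Bool) → Vec ℕ n → Bool
anyVec p Vec.[] = false
anyVec p (y Vec.∷ ys) = p y ∨ anyVec p ys

occursT : ℕ → Term → Bool
occursT x (var y) = y ≡ᵇ x
occursT x (prim n i ys) = anyVec (_≡ᵇ x) ys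
occursT x (s · t) = occursT x s ∨ occursT x t
occursT x (s ⊕ t) = occursT x s ∨ occursT x t
occursT x (! t) = occursT x t

freeIn : ℕ → Formula → Bool
freeIn x (pv p) = false
freeIn x δ = false
freeIn x ⊥f = false
freeIn x (¬f A) = freeIn x A
freeIn x (A ∧f B) = freeIn x A ∨ freeIn x B
freeIn x (A ∨f B) = freeIn x A ∨ freeIn x B
freeIn x (A ⇒ B) = freeIn x A ∨ freeIn x B
freeIn x (t ∶ A) = occursT x t ∨ freeIn x A
freeIn x (∀f y A) = not (y ≡ᵇ x) ∧ freeIn x A
freeIn x (∃f y A) = not (y ≡ᵇ x) ∧ freeIn x A

-- It is partial: it yields 'nothing' exactly when t is not free for x
-- in A (a free occurrence of x lies in the scope of a quantifier binding
-- a variable of t), or when the result would not be well formed, namely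
-- when a non-variable term would have to replace an argument of a
-- primitive term f(x₁,…,xₙ).

map2 : ∀ {A B C : Set} → (A → B → C) → Maybe A → Maybe B → Maybe C
map2 f (just a) (just b) = just (f a b)
map2 f _ _ = nothing

substT : Term → ℕ → Term → Maybe Term
substT t x (var y) = if y ≡ᵇ x then just t else just (var y)
substT t x (prim n i ys) with anyVec (_≡ᵇ x) ys | t
... | false | _     = just (prim n i ys)
... | true  | var z = just (prim n i (Vec.map (λ y → if y ≡ᵇ x then z else y) ys))
... | true  | _     = nothing
substT t x (s · u) = map2 _·_ (substT t x s) (substT t x u)
substT t x (s ⊕ u) = map2 _⊕_ (substT t x s) (substT t x u)
substT t x (! s) = Maybe.map !_ (substT t x s)

subst : Term → ℕ → Formula → Maybe Formula
subst t x (pv p) = just (pv p)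
subst t x δ = just δ
subst t x ⊥f = just ⊥f
subst t x (¬f A) = Maybe.map ¬f (subst t x A)
subst t x (A ∧f B) = map2 _∧f_ (subst t x A) (subst t x B)
subst t x (A ∨f B) = map2 _∨f_ (subst t x A) (subst t x B)
subst t x (A ⇒ B) = map2 _⇒_ (subst t x A) (subst t x B)
subst t x (s ∶ A) = map2 _∶_ (substT t x s) (subst t x A)
subst t x (∀f y A) =
  if y ≡ᵇ x then just (∀f y A)
  else (if freeIn x A ∧ occursT y t then nothing
        else Maybe.map (∀f y) (subst t x A))
subst t x (∃f y A) =
  if y ≡ᵇ x then just (∃f y A)
  else (if freeIn x A ∧ occursT y t then nothing
        else Maybe.map (∃f y) (subst t x A))

-- Propositional tautologies: formulas true under every Boolean valuation
-- of their prime (non-propositionally-compound) subformulas, i.e. of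
-- propositional variables, δ, t:A, (∀x)A and (∃x)A.

eval : (Formula → Bool) → Formula → Bool
eval v ⊥f = false
eval v (¬f A) = not (eval v A)
eval v (A ∧f B) = eval v A ∧ eval v B
eval v (A ∨f B) = eval v A ∨ eval v B
eval v (A ⇒ B) = not (eval v A) ∨ eval v B
eval v A = v A

Tautology : Formula → Set
Tautology A = (v : Formula → Bool) → eval v A ≡ true

δ-axiom : ℕ → Formula
δ-axiom E =
  δ ⇔ (∃f 0 (var 0 ∶ ¬f δ) ∨f (pv E ∧f ¬f (∃f 0 (var 0 ∶ (δ ⇒ pv E)))))

data Axiom (E : ℕ) : Formula → Set where
  taut : ∀ {A} → Tautology A → Axiom E A
  Q1   : ∀ {x A A'} t → subst t x A ≡ just A' → Axiom E (∀f x A ⇒ A')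
  Q2   : ∀ {x A B} → freeIn x A ≡ false →
         Axiom E (∀f x (A ⇒ B) ⇒ (A ⇒ ∀f x B))
  Q3   : ∀ {x A A'} t → subst t x A ≡ just A' → Axiom E (A' ⇒ ∃f x A)
  Q4   : ∀ {x A B} → freeIn x B ≡ false →
         Axiom E (∀f x (A ⇒ B) ⇒ (∃f x A ⇒ B))
  jK   : ∀ {s t A B} → Axiom E (s ∶ (A ⇒ B) ⇒ (t ∶ A ⇒ (s · t) ∶ B))
  jT   : ∀ {t A} → Axiom E (t ∶ A ⇒ A)
  j4   : ∀ {t A} → Axiom E (t ∶ A ⇒ (! t) ∶ (t ∶ A))
  sumL : ∀ {s t A} → Axiom E (s ∶ A ⇒ (s ⊕ t) ∶ A)
  sumR : ∀ {s t A} → Axiom E (s ∶ A ⇒ (t ⊕ s) ∶ A)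
  δax  : Axiom E (δ-axiom E)

data Thm (E : ℕ) : Formula → Set where
  ax  : ∀ {A} → Axiom E A → Thm E A
  mp  : ∀ {A B} → Thm E (A ⇒ B) → Thm E A → Thm E B
  gen : ∀ {A} x → Thm E A → Thm E (∀f x A)

Consistent : ℕ → Set
Consistent E = ¬ Thm E ⊥f

module Submission where

-- Without Axiom Necessitation no justification assertion t:A is ever
-- forced to be derivable, so we may read every t:A as false.  Reading
-- moreover the quantifiers as vacuous ((∀x)A and (∃x)A mean A), the
-- propositional variables by an arbitrary valuation ρ and δ as the value
-- of E, every formula gets a truth value ⟦A⟧.  Under this reading
--   * tautologies are true, since ⟦_⟧ is itself a Boolean valuation of
--     the prime formulas that agrees with ⟦_⟧ on compound ones;
--   * Q1 and Q3 are true, because substitution (whenever defined) does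
--     not change ⟦_⟧; Q2 and Q4 become instances of b → b;
--   * jK, jT, j4 and Sum have a false premise t:A;
--   * the δ axiom becomes E ↔ (false ∨ (E ∧ ¬false)), a tautology;
-- and Modus Ponens and Gen preserve truth.  Hence every theorem is true
-- while ⊥ is false, so ⊥ is not a theorem.

open import Defs
open import Data.Nat using (ℕ; _≡ᵇ_)
open import Data.Bool using (Bool; true; false; _∧_; _∨_; not; if_then_else_)
open import Data.Bool.Properties using (∨-inverseˡ)
open import Data.Maybe using (Maybe; just; nothing)
open import Data.Maybe.Relation.Unary.All using (All; just; nothing; drop-just)
open import Data.Maybe.Relation.Unary.All.Properties using (map⁺; gmap)
open import Data.Unit using (⊤; tt)
open import Relation.Binary.PropositionalEquality
  using (_≡_; refl; cong; cong₂)
  renaming (subst to transport)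

map2-All : ∀ {A B C : Set} {P : A → Set} {Q : B → Set} {R : C → Set}
             {f : A → B → C} →
           (∀ {a b} → P a → Q b → R (f a b)) →
           ∀ {m n} → All P m → All Q n → All R (map2 f m n)
map2-All h (just p) (just q) = just (h p q)
map2-All h (just p) nothing  = nothing
map2-All h nothing  _        = nothing

if-All : ∀ {A : Set} {P : A → Set} b {m n : Maybe A} →
         All P m → All P n → All P (if b then m else n)
if-All true  pm pn = pm
if-All false pm pn = pn

everywhere-All : ∀ {A : Set} {P : A → Set} → (∀ a → P a) → (m : Maybe A) → All P m
everywhere-All h (just a) = just (h a)
everywhere-All h nothing  = nothing

bool-mp : ∀ a b → not a ∨ b ≡ true → a ≡ true → b ≡ true
bool-mp true b a⇒b refl = a⇒b

module Erasure (ρ : ℕ → Bool) (E : ℕ) where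

  ⟦_⟧ : Formula → Bool
  ⟦ pv p ⟧     = ρ p
  ⟦ δ ⟧        = ρ E
  ⟦ ⊥f ⟧       = false
  ⟦ ¬f A ⟧     = not ⟦ A ⟧
  ⟦ A ∧f B ⟧   = ⟦ A ⟧ ∧ ⟦ B ⟧
  ⟦ A ∨f B ⟧   = ⟦ A ⟧ ∨ ⟦ B ⟧
  ⟦ A ⇒ B ⟧    = not ⟦ A ⟧ ∨ ⟦ B ⟧
  ⟦ t ∶ A ⟧    = false
  ⟦ ∀f x A ⟧   = ⟦ A ⟧
  ⟦ ∃f x A ⟧   = ⟦ A ⟧

  eval-⟦⟧ : ∀ A → eval ⟦_⟧ A ≡ ⟦ A ⟧
  eval-⟦⟧ (pv p)   = refl
  eval-⟦⟧ δ        = refl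
  eval-⟦⟧ ⊥f       = refl
  eval-⟦⟧ (¬f A)   = cong not (eval-⟦⟧ A)
  eval-⟦⟧ (A ∧f B) = cong₂ _∧_ (eval-⟦⟧ A) (eval-⟦⟧ B)
  eval-⟦⟧ (A ∨f B) = cong₂ _∨_ (eval-⟦⟧ A) (eval-⟦⟧ B)
  eval-⟦⟧ (A ⇒ B)  = cong₂ (λ a b → not a ∨ b) (eval-⟦⟧ A) (eval-⟦⟧ B)
  eval-⟦⟧ (t ∶ A)  = refl
  eval-⟦⟧ (∀f x A) = refl
  eval-⟦⟧ (∃f x A) = refl

  -- Substitution never changes the value of a formula: justification
  -- assertions stay false and quantifiers are transparent.
  SameValue : Formula → Formula → Set
  SameValue A A' = ⟦ A' ⟧ ≡ ⟦ A ⟧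

  subst-preserves : ∀ t x A → All (SameValue A) (subst t x A)
  subst-preserves t x (pv p)   = just refl
  subst-preserves t x δ        = just refl
  subst-preserves t x ⊥f       = just refl
  subst-preserves t x (¬f A)   = gmap (cong not) (subst-preserves t x A)
  subst-preserves t x (A ∧f B) =
    map2-All (cong₂ _∧_) (subst-preserves t x A) (subst-preserves t x B)
  subst-preserves t x (A ∨f B) =
    map2-All (cong₂ _∨_) (subst-preserves t x A) (subst-preserves t x B)
  subst-preserves t x (A ⇒ B)  =
    map2-All (cong₂ (λ a b → not a ∨ b)) (subst-preserves t x A) (subst-preserves t x B)
  subst-preserves t x (s ∶ A)  =
    map2-All {P = λ _ → ⊤} (λ _ _ → refl) (everywhere-All (λ _ → tt) (substT t x s))
      (subst-preserves t x A)
  subst-preserves t x (∀f y A) =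
    if-All (y ≡ᵇ x) (just refl)
      (if-All (freeIn x A ∧ occursT y t) nothing (map⁺ {f = ∀f y} (subst-preserves t x A)))
  subst-preserves t x (∃f y A) =
    if-All (y ≡ᵇ x) (just refl)
      (if-All (freeIn x A ∧ occursT y t) nothing (map⁺ {f = ∃f y} (subst-preserves t x A)))

  substituted-value : ∀ t x A {A'} → subst t x A ≡ just A' → ⟦ A' ⟧ ≡ ⟦ A ⟧
  substituted-value t x A eq =
    drop-just (transport (All (SameValue A)) eq (subst-preserves t x A))

  -- The δ axiom reduces to  E ↔ (E ∧ true).
  δ-axiom-true : ⟦ δ-axiom E ⟧ ≡ true
  δ-axiom-true with ρ E
  ... | true  = refl
  ... | false = refl

  -- Every axiom is true: Q1–Q4 are instances of  not b ∨ b, the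
  -- justification axioms have the false premise t:A.
  axiom-true : ∀ {A} → Axiom E A → ⟦ A ⟧ ≡ true
  axiom-true {A} (taut τ) = transport (_≡ true) (eval-⟦⟧ A) (τ ⟦_⟧)
  axiom-true (Q1 {x} {A} t eq) rewrite substituted-value t x A eq = ∨-inverseˡ ⟦ A ⟧
  axiom-true (Q2 {A = A} {B} _) = ∨-inverseˡ (not ⟦ A ⟧ ∨ ⟦ B ⟧)
  axiom-true (Q3 {x} {A} t eq) rewrite substituted-value t x A eq = ∨-inverseˡ ⟦ A ⟧
  axiom-true (Q4 {A = A} {B} _) = ∨-inverseˡ (not ⟦ A ⟧ ∨ ⟦ B ⟧)
  axiom-true jK   = refl
  axiom-true jT   = refl
  axiom-true j4   = refl
  axiom-true sumL = refl
  axiom-true sumR = refl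
  axiom-true δax  = δ-axiom-true

  sound : ∀ {A} → Thm E A → ⟦ A ⟧ ≡ true
  sound (ax a)                = axiom-true a
  sound (mp {A} {B} ⊢A⇒B ⊢A) = bool-mp ⟦ A ⟧ ⟦ B ⟧ (sound ⊢A⇒B) (sound ⊢A)
  sound (gen x ⊢A)            = sound ⊢A

theorem26 : (E : ℕ) → Consistent E
theorem26 E ⊢⊥ with Erasure.sound (λ _ → false) E ⊢⊥
... | ()
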